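{- Let $Z=\{z_1,\dots,z_N\}\subset\{0,1\}^n$ be a subset of size $N$ with distance distribution $(A_0,A_1,\dots,A_n)$. Then $$D^{L_2}(Z)=\Lambda_n-\frac1N\sum_{w=1}^n A_w\lambda(w),$$ where $\Lambda_n=\frac{n}{2^{n+1}}\binom{2n}{n}$ and $\lambda(w)=2^{n-w}w\binom{w-1}{\lceil w/2\rceil-1}$.
   Context: $d$ is the Hamming distance on $\{0,1\}^n$ and $B(x,t)=\{y: d(x,y)\le t\}$. The quadratic discrepancy is $D^{L_2}(Z)=\sum_{t=0}^n\sum_{x\in\{0,1\}^n}\Big(\frac1N\sum_{j=1}^N\mathbb 1_{B(x,t)}(z_j)-\frac{|B(x,t)|}{2^n}\Big)^2$. The distance distribution of $Z$ is $A_w=\frac1N|\{(z,z')\in Z^2: d(z,z')=w\}|$ (ordered pairs), $w=0,\dots,n$. -}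

module Defs where

open import Data.Bool using (Bool; true; false; if_then_else_)
open import Data.Nat as ℕ using (ℕ; zero; suc; NonZero; ⌈_/2⌉; _∸_; _≤ᵇ_; _≡ᵇ_)
open import Data.Nat.Properties using (m^n≢0)
open import Data.Nat.Combinatorics using (_C_)
open import Data.Integer using (+_)
open import Data.Fin using (Fin)
open import Data.Vec using (Vec; []; _∷_)
open import Data.List using (List; []; _∷_; map; concatMap; foldr; upTo; allFin; length; filter)
open import Data.Rational using (ℚ; 0ℚ; _+_; _-_; _*_; _/_)

hamming : ∀ {n} → Vec Bool n → Vec Bool n → ℕ
hamming []       []       = 0
hamming (a ∷ x) (b ∷ y) = (if a Data.Bool.xor b then 1 else 0) ℕ.+ hamming x y

allVecs : (n : ℕ) → List (Vec Bool n)
allVecs zero    = [] ∷ []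
allVecs (suc n) = concatMap (λ v → (false ∷ v) ∷ (true ∷ v) ∷ []) (allVecs n)

indB : ∀ {n} → Vec Bool n → ℕ → Vec Bool n → ℕ
indB x t z = if hamming x z ≤ᵇ t then 1 else 0

sumℕ : List ℕ → ℕ
sumℕ = foldr ℕ._+_ 0

sumℚ : List ℚ → ℚ
sumℚ = foldr _+_ 0ℚ

ballSize : ∀ {n} → Vec Bool n → ℕ → ℕ
ballSize {n} x t = sumℕ (map (indB x t) (allVecs n))

DL2 : ∀ {n} (N : ℕ) .{{_ : NonZero N}} → (Fin N → Vec Bool n) → ℚ
DL2 {n} N z =
  sumℚ (map (λ t → sumℚ (map (λ x →
    let e = (+ sumℕ (map (λ j → indB x t (z j)) (allFin N))) / N
          - ((+ ballSize x t) / (2 ℕ.^ n)) {{m^n≢0 2 n}}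
    in e * e) (allVecs n))) (upTo (suc n)))

A : ∀ {n} (N : ℕ) .{{_ : NonZero N}} → (Fin N → Vec Bool n) → ℕ → ℚ
A N z w = (+ sumℕ (concatMap (λ i → map (λ j → if hamming (z i) (z j) ≡ᵇ w then 1 else 0) (allFin N)) (allFin N))) / N

Λ : ℕ → ℚ
Λ n = ((+ (n ℕ.* ((2 ℕ.* n) C n))) / (2 ℕ.^ suc n)) {{m^n≢0 2 (suc n)}}

lam : ℕ → ℕ → ℕ
lam n w = 2 ℕ.^ (n ∸ w) ℕ.* w ℕ.* ((w ∸ 1) C (⌈ w /2⌉ ∸ 1))

module Submission where

-- Writing c(x,t) = |Z ∩ B(x,t)| and |B_t| for the common volume of the balls of
-- radius t, expanding the square gives
--   D^{L₂}(Z) = N⁻²·∑_{t,x} c² + 2⁻²ⁿ·∑_{t,x} |B_t|² − 2·N⁻¹2⁻ⁿ·∑_{t,x} |B_t|·c.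
-- The last two sums are 2ⁿ·F₂ and N·F₂ with F₂ = ∑_t |B_t|². The first is a sum
-- over pairs (zᵢ,zⱼ) of ∑_t |B(zᵢ,t) ∩ B(zⱼ,t)|, and the heart of the proof is
-- the pair identity  ∑_t |B(a,t) ∩ B(b,t)| + λ(d(a,b)) = F₁ := ∑_t |B_t|.
-- By a layer-cake count over the thresholds t, the defect equals
-- ∑_x (d(b,x) ∸ d(a,x)), which depends only on w = d(a,b) and equals
-- 2^(n−w)·∑ⱼ C(w,j)·(2j − w)⁺ = λ(w) by a telescoping binomial sum.
-- The same count gives 2·(2ⁿF₁ − F₂) = n·C(2n,n), i.e. F₁ − 2⁻ⁿF₂ = Λₙ.

open import Data.Bool using (Bool)
open import Data.Nat using (ℕ; suc; NonZero; _^_)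
open import Data.Fin using (Fin)
open import Data.Vec using (Vec)

module FiniteSums where

  open import Data.Nat
  open import Data.Nat.Properties
  open import Data.List using (List; []; _∷_; map; concatMap; upTo; _++_; length)
  open import Data.List.Properties using (map-++; upTo-∷ʳ)
  open import Data.Nat.ListAction.Properties using (sum-++)
  open import Algebra.Properties.CommutativeSemigroup +-commutativeSemigroup using (interchange)
  open import Relation.Binary.PropositionalEquality
  open ≡-Reasoning
  open import Defs using (sumℕ)

  private variable
    X Y : Set

  ∑ : List X → (X → ℕ) → ℕ
  ∑ L f = sumℕ (map f L)

  ∑-cong : ∀ (L : List X) {f g : X → ℕ} → (∀ x → f x ≡ g x) → ∑ L f ≡ ∑ L g
  ∑-cong []      f≗g = refl
  ∑-cong (x ∷ L) f≗g = cong₂ _+_ (f≗g x) (∑-cong L f≗g)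

  ∑-+ : ∀ (L : List X) (f g : X → ℕ) → ∑ L (λ x → f x + g x) ≡ ∑ L f + ∑ L g
  ∑-+ []      f g = refl
  ∑-+ (x ∷ L) f g = trans (cong (f x + g x +_) (∑-+ L f g)) (interchange (f x) (g x) (∑ L f) (∑ L g))

  ∑-*ˡ : ∀ (L : List X) c (f : X → ℕ) → ∑ L (λ x → c * f x) ≡ c * ∑ L f
  ∑-*ˡ []      c f = sym (*-zeroʳ c)
  ∑-*ˡ (x ∷ L) c f = trans (cong (c * f x +_) (∑-*ˡ L c f)) (sym (*-distribˡ-+ c (f x) _))

  ∑-*ʳ : ∀ (L : List X) c (f : X → ℕ) → ∑ L (λ x → f x * c) ≡ ∑ L f * c
  ∑-*ʳ L c f = trans (∑-cong L (λ x → *-comm (f x) c)) (trans (∑-*ˡ L c f) (*-comm c _))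

  ∑-const : ∀ (L : List X) c → ∑ L (λ _ → c) ≡ length L * c
  ∑-const []      c = refl
  ∑-const (x ∷ L) c = cong (c +_) (∑-const L c)

  ∑-swap : ∀ (L : List X) (M : List Y) (f : X → Y → ℕ) →
    ∑ L (λ x → ∑ M (f x)) ≡ ∑ M (λ y → ∑ L (λ x → f x y))
  ∑-swap []      M f = sym (trans (∑-const M 0) (*-zeroʳ (length M)))
  ∑-swap (x ∷ L) M f = trans (cong (∑ M (f x) +_) (∑-swap L M f))
                             (sym (∑-+ M (f x) (λ y → ∑ L (λ x → f x y))))

  ∑-concatMap : ∀ (L : List X) (M : List Y) (f : X → Y → ℕ) →
    sumℕ (concatMap (λ x → map (f x) M) L) ≡ ∑ L (λ x → ∑ M (f x))
  ∑-concatMap []      M f = refl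
  ∑-concatMap (x ∷ L) M f = trans (sum-++ (map (f x) M) _) (cong (∑ M (f x) +_) (∑-concatMap L M f))

  ∑-upTo-suc : ∀ K (f : ℕ → ℕ) → ∑ (upTo (suc K)) f ≡ ∑ (upTo K) f + f K
  ∑-upTo-suc K f = begin
    ∑ (upTo (suc K)) f                   ≡⟨ cong (λ l → ∑ l f) (upTo-∷ʳ K) ⟨
    sumℕ (map f (upTo K ++ K ∷ []))       ≡⟨ cong sumℕ (map-++ f (upTo K) (K ∷ [])) ⟩
    sumℕ (map f (upTo K) ++ f K ∷ [])     ≡⟨ sum-++ (map f (upTo K)) (f K ∷ []) ⟩
    ∑ (upTo K) f + (f K + 0)              ≡⟨ cong (∑ (upTo K) f +_) (+-identityʳ (f K)) ⟩
    ∑ (upTo K) f + f K                    ∎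

module Hypercube where

  open import Data.Bool using (Bool; true; false)
  open import Data.Nat
  open import Data.Nat.Properties
  open import Data.Vec using (Vec; []; _∷_)
  open import Data.List using (List; []; _∷_; length; concatMap)
  open import Relation.Binary.PropositionalEquality
  open import Data.Nat.Tactic.RingSolver using (solve-∀)
  open import Defs using (hamming; allVecs)
  open FiniteSums

  ∑cube : ∀ n → (Vec Bool n → ℕ) → ℕ
  ∑cube n g = ∑ (allVecs n) g

  ∑cube-split : ∀ n (g : Vec Bool (suc n) → ℕ) →
    ∑cube (suc n) g ≡ ∑cube n (λ v → g (false ∷ v)) + ∑cube n (λ v → g (true ∷ v))
  ∑cube-split n g = go (allVecs n)
    where
    regroup : ∀ a b c d → a + (b + (c + d)) ≡ (a + c) + (b + d)
    regroup = solve-∀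

    go : ∀ (L : List (Vec Bool n)) →
      ∑ (concatMap (λ v → (false ∷ v) ∷ (true ∷ v) ∷ []) L) g ≡
      ∑ L (λ v → g (false ∷ v)) + ∑ L (λ v → g (true ∷ v))
    go []      = refl
    go (v ∷ L) = trans (cong (λ s → g (false ∷ v) + (g (true ∷ v) + s)) (go L))
                       (regroup (g (false ∷ v)) (g (true ∷ v)) (∑ L (λ v → g (false ∷ v))) (∑ L (λ v → g (true ∷ v))))

  length-allVecs : ∀ n → length (allVecs n) ≡ 2 ^ n
  length-allVecs zero    = refl
  length-allVecs (suc n) = trans (go (allVecs n)) (cong (λ k → k + (k + 0)) (length-allVecs n))
    where
    go : ∀ (L : List (Vec Bool n)) → length (concatMap (λ v → (false ∷ v) ∷ (true ∷ v) ∷ []) L) ≡ length L + (length L + 0)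
    go []      = refl
    go (v ∷ L) = cong suc (trans (cong suc (go L)) (sym (+-suc (length L) (length L + 0))))

  ∑cube-const : ∀ n c → ∑cube n (λ _ → c) ≡ 2 ^ n * c
  ∑cube-const n c = trans (∑-const (allVecs n) c) (cong (_* c) (length-allVecs n))

  hamming-sym : ∀ {n} (x y : Vec Bool n) → hamming x y ≡ hamming y x
  hamming-sym []          []          = refl
  hamming-sym (false ∷ x) (false ∷ y) = hamming-sym x y
  hamming-sym (false ∷ x) (true ∷ y)  = cong suc (hamming-sym x y)
  hamming-sym (true ∷ x)  (false ∷ y) = cong suc (hamming-sym x y)
  hamming-sym (true ∷ x)  (true ∷ y)  = hamming-sym x y

  hamming-≤ : ∀ {n} (x y : Vec Bool n) → hamming x y ≤ n
  hamming-≤ []          []          = z≤n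
  hamming-≤ (false ∷ x) (false ∷ y) = m≤n⇒m≤1+n (hamming-≤ x y)
  hamming-≤ (false ∷ x) (true ∷ y)  = s≤s (hamming-≤ x y)
  hamming-≤ (true ∷ x)  (false ∷ y) = s≤s (hamming-≤ x y)
  hamming-≤ (true ∷ x)  (true ∷ y)  = m≤n⇒m≤1+n (hamming-≤ x y)

  -- Summing a function of the distance to a ∷ x over {0,1}^(n+1): one face
  -- keeps the distance to x, the other adds 1, whatever the bit a is.
  ∑cube-radial-split : ∀ n a (x : Vec Bool n) (g : ℕ → ℕ) →
    ∑cube (suc n) (λ u → g (hamming (a ∷ x) u)) ≡
    ∑cube n (λ u → g (hamming x u)) + ∑cube n (λ u → g (suc (hamming x u)))
  ∑cube-radial-split n false x g = ∑cube-split n _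
  ∑cube-radial-split n true  x g = trans (∑cube-split n _) (+-comm (∑cube n (λ u → g (suc (hamming x u)))) _)

  ∑cube-radial : ∀ n (g : ℕ → ℕ) (x y : Vec Bool n) →
    ∑cube n (λ u → g (hamming x u)) ≡ ∑cube n (λ u → g (hamming y u))
  ∑cube-radial zero    g []      []      = refl
  ∑cube-radial (suc n) g (a ∷ x) (b ∷ y) = begin
    ∑cube (suc n) (λ u → g (hamming (a ∷ x) u))
      ≡⟨ ∑cube-radial-split n a x g ⟩
    ∑cube n (λ u → g (hamming x u)) + ∑cube n (λ u → g (suc (hamming x u)))
      ≡⟨ cong₂ _+_ (∑cube-radial n g x y) (∑cube-radial n (λ k → g (suc k)) x y) ⟩
    ∑cube n (λ u → g (hamming y u)) + ∑cube n (λ u → g (suc (hamming y u)))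
      ≡⟨ ∑cube-radial-split n b y g ⟨
    ∑cube (suc n) (λ u → g (hamming (b ∷ y) u)) ∎
    where open ≡-Reasoning

  zeros : ∀ n → Vec Bool n
  zeros zero    = []
  zeros (suc n) = false ∷ zeros n

  weight : ∀ {n} → Vec Bool n → ℕ
  weight {n} u = hamming (zeros n) u

module Binomials where

  open import Data.Nat
  open import Data.Nat.Properties
  open import Data.Nat.Combinatorics using (_C_; nCk+nC[k+1]≡[n+1]C[k+1])
  open import Data.Nat.Tactic.RingSolver using (solve-∀)
  open import Relation.Binary.PropositionalEquality
  open import Relation.Nullary using (yes; no)
  open ≡-Reasoning

  -- Binomial coefficients by Pascal's rule; they agree with _C_ (binom≡C) but
  -- their recursion is the one the sums below unfold along.
  binom : ℕ → ℕ → ℕ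
  binom n       zero    = 1
  binom zero    (suc k) = 0
  binom (suc n) (suc k) = binom n k + binom n (suc k)

  binom≡C : ∀ n k → binom n k ≡ n C k
  binom≡C n       zero    = refl
  binom≡C zero    (suc k) = refl
  binom≡C (suc n) (suc k) = trans (cong₂ _+_ (binom≡C n k) (binom≡C n (suc k))) (nCk+nC[k+1]≡[n+1]C[k+1] n k)

  binom-vanishes : ∀ n k → n < k → binom n k ≡ 0
  binom-vanishes zero    (suc k) _         = refl
  binom-vanishes (suc n) (suc k) (s≤s n<k) = cong₂ _+_ (binom-vanishes n k n<k) (binom-vanishes n (suc k) (m<n⇒m<1+n n<k))

  binom-1 : ∀ n → binom n 1 ≡ n
  binom-1 zero    = refl
  binom-1 (suc n) = cong suc (binom-1 n)

  absorption : ∀ n k → suc k * binom (suc n) (suc k) ≡ suc n * binom n k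
  absorption n       zero     = trans (*-identityˡ _) (trans (binom-1 (suc n)) (sym (*-identityʳ (suc n))))
  absorption zero    (suc k)  = *-zeroʳ (suc (suc k))
  absorption (suc m) (suc k′) = begin
    suc k * (binom (suc m) k + binom (suc m) (suc k))
      ≡⟨ *-distribˡ-+ (suc k) (binom (suc m) k) (binom (suc m) (suc k)) ⟩
    suc k * binom (suc m) k + suc k * binom (suc m) (suc k)
      ≡⟨ cong (suc k * binom (suc m) k +_) (absorption m k) ⟩
    binom (suc m) k + k * binom (suc m) k + suc m * binom m k
      ≡⟨ cong (λ e → binom (suc m) k + e + suc m * binom m k) (absorption m k′) ⟩
    (binom m k′ + binom m k) + suc m * binom m k′ + suc m * binom m k
      ≡⟨ collect m (binom m k′) (binom m k) ⟩
    suc (suc m) * (binom m k′ + binom m k) ∎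
    where
    k : ℕ
    k = suc k′
    collect : ∀ m x y → (x + y) + suc m * x + suc m * y ≡ suc (suc m) * (x + y)
    collect = solve-∀

  absorption-compl : ∀ n k → (suc n ∸ k) * binom (suc n) k ≡ suc n * binom n k
  absorption-compl n zero = refl
  absorption-compl n (suc k) with k ≤? n
  ... | no k≰n = begin
    (n ∸ k) * binom (suc n) (suc k) ≡⟨ cong (_* binom (suc n) (suc k)) (m≤n⇒m∸n≡0 (<⇒≤ n<k)) ⟩
    0                               ≡⟨ *-zeroʳ (suc n) ⟨
    suc n * 0                       ≡⟨ cong (suc n *_) (binom-vanishes n (suc k) (m<n⇒m<1+n n<k)) ⟨
    suc n * binom n (suc k)         ∎
    where
    n<k : n < k
    n<k = ≰⇒> k≰n
  ... | yes k≤n = +-cancelˡ-≡ (suc n * binom n k) _ _ (begin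
    suc n * binom n k + (n ∸ k) * B   ≡⟨ cong (_+ (n ∸ k) * B) (absorption n k) ⟨
    suc k * B + (n ∸ k) * B           ≡⟨ *-distribʳ-+ B (suc k) (n ∸ k) ⟨
    (suc k + (n ∸ k)) * B             ≡⟨ cong (λ m → suc m * B) (m+[n∸m]≡n k≤n) ⟩
    suc n * B                         ≡⟨ *-distribˡ-+ (suc n) (binom n k) (binom n (suc k)) ⟩
    suc n * binom n k + suc n * binom n (suc k) ∎)
    where
    B : ℕ
    B = binom (suc n) (suc k)

  ∑< : ℕ → (ℕ → ℕ) → ℕ
  ∑< zero    f = 0
  ∑< (suc K) f = ∑< K f + f K

  ∑<-cong : ∀ K (f g : ℕ → ℕ) → (∀ j → j < K → f j ≡ g j) → ∑< K f ≡ ∑< K g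
  ∑<-cong zero    f g f≗g = refl
  ∑<-cong (suc K) f g f≗g = cong₂ _+_ (∑<-cong K f g (λ j j<K → f≗g j (m<n⇒m<1+n j<K))) (f≗g K (n<1+n K))

  ∑<-+ : ∀ K (f g : ℕ → ℕ) → ∑< K (λ j → f j + g j) ≡ ∑< K f + ∑< K g
  ∑<-+ zero    f g = refl
  ∑<-+ (suc K) f g = trans (cong (_+ (f K + g K)) (∑<-+ K f g)) (interchange (∑< K f) (∑< K g) (f K) (g K))
    where open import Algebra.Properties.CommutativeSemigroup +-commutativeSemigroup using (interchange)

  ∑<-shift : ∀ K (f : ℕ → ℕ) → ∑< (suc K) f ≡ f 0 + ∑< K (λ j → f (suc j))
  ∑<-shift zero    f = +-comm 0 (f 0)
  ∑<-shift (suc K) f = trans (cong (_+ f (suc K)) (∑<-shift K f)) (+-assoc (f 0) _ _)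

  ∑binom : ℕ → (ℕ → ℕ) → ℕ
  ∑binom w f = ∑< (suc w) (λ j → binom w j * f j)

  ∑binom-cong : ∀ w (f g : ℕ → ℕ) → (∀ j → j ≤ w → f j ≡ g j) → ∑binom w f ≡ ∑binom w g
  ∑binom-cong w f g f≗g = ∑<-cong (suc w) _ _ (λ j j<1+w → cong (binom w j *_) (f≗g j (≤-pred j<1+w)))

  ∑binom-pascal : ∀ w (f : ℕ → ℕ) → ∑binom (suc w) f ≡ ∑binom w f + ∑binom w (λ j → f (suc j))
  ∑binom-pascal w f = begin
    ∑binom (suc w) f
      ≡⟨ ∑<-shift (suc w) _ ⟩
    1 * f 0 + ∑< (suc w) (λ j → (binom w j + binom w (suc j)) * f (suc j))
      ≡⟨ cong (1 * f 0 +_) (∑<-cong (suc w) _ _ (λ j _ → *-distribʳ-+ (f (suc j)) (binom w j) (binom w (suc j)))) ⟩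
    1 * f 0 + ∑< (suc w) (λ j → binom w j * f (suc j) + binom w (suc j) * f (suc j))
      ≡⟨ cong (1 * f 0 +_) (∑<-+ (suc w) _ _) ⟩
    1 * f 0 + (∑binom w g + (X + binom w (suc w) * f (suc w)))
      ≡⟨ cong (λ c → 1 * f 0 + (∑binom w g + (X + c * f (suc w)))) (binom-vanishes w (suc w) (n<1+n w)) ⟩
    1 * f 0 + (∑binom w g + (X + 0))
      ≡⟨ regroup (1 * f 0) (∑binom w g) X ⟩
    (1 * f 0 + X) + ∑binom w g
      ≡⟨ cong (_+ ∑binom w g) (∑<-shift w _) ⟨
    ∑binom w f + ∑binom w g ∎
    where
    g : ℕ → ℕ
    g j = f (suc j)
    X : ℕ
    X = ∑< w (λ j → binom w (suc j) * f (suc j))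
    regroup : ∀ a b c → a + (b + (c + 0)) ≡ (a + c) + b
    regroup = solve-∀

  -- It is the sum of (q + d(b,u)) ∸ (p + d(a,u)) over the
  -- u ∈ {0,1}^w, for two points a, b at distance w (see excessSum≡excess).
  excess : ℕ → ℕ → ℕ → ℕ
  excess zero    p q = q ∸ p
  excess (suc w) p q = excess w (suc p) q + excess w p (suc q)

  excess-closed : ∀ w p q → excess w p q ≡ ∑binom w (λ j → (q + j) ∸ (p + (w ∸ j)))
  excess-closed zero    p q = sym (trans (+-identityˡ _) (trans (*-identityˡ _) (cong₂ _∸_ (+-identityʳ q) (+-identityʳ p))))
  excess-closed (suc w) p q = begin
    excess w (suc p) q + excess w p (suc q)
      ≡⟨ cong₂ _+_ (excess-closed w (suc p) q) (excess-closed w p (suc q)) ⟩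
    ∑binom w (λ j → (q + j) ∸ (suc p + (w ∸ j))) + ∑binom w (λ j → (suc q + j) ∸ (p + (w ∸ j)))
      ≡⟨ cong₂ _+_ (∑binom-cong w _ _ (λ j j≤w → cong ((q + j) ∸_) (sym (trans (cong (p +_) (+-∸-assoc 1 j≤w)) (+-suc p (w ∸ j))))))
                   (∑binom-cong w _ _ (λ j _ → cong (_∸ (p + (w ∸ j))) (sym (+-suc q j)))) ⟩
    ∑binom w F + ∑binom w (λ j → F (suc j))
      ≡⟨ ∑binom-pascal w F ⟨
    ∑binom (suc w) F ∎
    where
    F : ℕ → ℕ
    F j = (q + j) ∸ (p + (suc w ∸ j))

  excess-shift : ∀ w p q → excess w (suc p) (suc q) ≡ excess w p q
  excess-shift zero    p q = refl
  excess-shift (suc w) p q = cong₂ _+_ (excess-shift w (suc p) q) (excess-shift w p (suc q))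

  -- Two bounds on ⌊v/2⌋, locating where 2j − (v + 1) changes sign.
  ⌊n/2⌋+⌊n/2⌋≤n : ∀ v → ⌊ v /2⌋ + ⌊ v /2⌋ ≤ v
  ⌊n/2⌋+⌊n/2⌋≤n v = subst (⌊ v /2⌋ + ⌊ v /2⌋ ≤_) (⌊n/2⌋+⌈n/2⌉≡n v) (+-monoʳ-≤ ⌊ v /2⌋ (⌊n/2⌋≤⌈n/2⌉ v))

  n≤1+⌊n/2⌋+⌊n/2⌋ : ∀ v → v ≤ suc (⌊ v /2⌋ + ⌊ v /2⌋)
  n≤1+⌊n/2⌋+⌊n/2⌋ zero          = z≤n
  n≤1+⌊n/2⌋+⌊n/2⌋ (suc zero)    = s≤s z≤n
  n≤1+⌊n/2⌋+⌊n/2⌋ (suc (suc v)) = s≤s (subst (suc v ≤_) (sym (cong suc (+-suc ⌊ v /2⌋ ⌊ v /2⌋))) (s≤s (n≤1+⌊n/2⌋+⌊n/2⌋ v)))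

  -- The terms with 2j ≤ w vanish and the others telescope, since
  -- C(w,j+1)·(2j+2−w) = w·(C(v,j) − C(v,j+1)) by the two absorption identities.
  module CentralExcess (v : ℕ) where

    w h : ℕ
    w = suc v
    h = ⌊ v /2⌋

    term : ℕ → ℕ
    term j = binom w j * (j ∸ (w ∸ j))

    term-vanishes : ∀ K → K ≤ h → ∑< (suc K) term ≡ 0
    term-vanishes K K≤h = trans (∑<-cong (suc K) term (λ _ → 0) zero-term) (zeros (suc K))
      where
      zeros : ∀ K → ∑< K (λ _ → 0) ≡ 0
      zeros zero    = refl
      zeros (suc K) = cong (_+ 0) (zeros K)
      zero-term : ∀ j → j < suc K → term j ≡ 0
      zero-term j j<1+K = trans (cong (binom w j *_) (m≤n⇒m∸n≡0 (m+n≤o⇒m≤o∸n j j+j≤w))) (*-zeroʳ (binom w j))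
        where
        j≤h : j ≤ h
        j≤h = ≤-trans (≤-pred j<1+K) K≤h
        j+j≤w : j + j ≤ w
        j+j≤w = ≤-trans (+-mono-≤ j≤h j≤h) (≤-trans (⌊n/2⌋+⌊n/2⌋≤n v) (n≤1+n v))

    telescoping-step : ∀ K → h ≤ K → term (suc K) + w * binom v (suc K) ≡ w * binom v K
    telescoping-step K h≤K = begin
      B * (suc K ∸ (v ∸ K)) + w * binom v (suc K) ≡⟨ cong (B * (suc K ∸ (v ∸ K)) +_) (absorption-compl v (suc K)) ⟨
      B * (suc K ∸ (v ∸ K)) + (v ∸ K) * B        ≡⟨ cong (B * (suc K ∸ (v ∸ K)) +_) (*-comm (v ∸ K) B) ⟩
      B * (suc K ∸ (v ∸ K)) + B * (v ∸ K)        ≡⟨ *-distribˡ-+ B (suc K ∸ (v ∸ K)) (v ∸ K) ⟨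
      B * ((suc K ∸ (v ∸ K)) + (v ∸ K))          ≡⟨ cong (B *_) (m∸n+n≡m v∸K≤1+K) ⟩
      B * suc K                                  ≡⟨ *-comm B (suc K) ⟩
      suc K * B                                  ≡⟨ absorption v K ⟩
      w * binom v K                              ∎
      where
      B : ℕ
      B = binom w (suc K)
      v∸K≤1+K : v ∸ K ≤ suc K
      v∸K≤1+K = ≤-trans (∸-monoˡ-≤ K (≤-trans (n≤1+⌊n/2⌋+⌊n/2⌋ v) (s≤s (+-mono-≤ h≤K h≤K))))
                        (≤-reflexive (m+n∸n≡m (suc K) K))

    partial-sum : ∀ K → h ≤ K → ∑< (suc K) term + w * binom v K ≡ w * binom v h
    partial-sum zero h≤0 rewrite n≤0⇒n≡0 h≤0 = cong (_+ w * binom v 0) (term-vanishes 0 z≤n)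
    partial-sum (suc K) h≤1+K with h ≤? K
    ... | yes h≤K = begin
      (∑< (suc K) term + term (suc K)) + w * binom v (suc K) ≡⟨ +-assoc (∑< (suc K) term) _ _ ⟩
      ∑< (suc K) term + (term (suc K) + w * binom v (suc K)) ≡⟨ cong (∑< (suc K) term +_) (telescoping-step K h≤K) ⟩
      ∑< (suc K) term + w * binom v K                        ≡⟨ partial-sum K h≤K ⟩
      w * binom v h                                          ∎
    ... | no h≰K rewrite ≤-antisym h≤1+K (≰⇒> h≰K) = cong (_+ w * binom v (suc K)) (term-vanishes (suc K) (≤-reflexive (≤-antisym (≰⇒> h≰K) h≤1+K)))

    excess-central : excess w 0 0 ≡ w * binom v h
    excess-central = begin
      excess w 0 0                    ≡⟨ excess-closed w 0 0 ⟩
      ∑< (suc w) term                 ≡⟨ +-identityʳ _ ⟨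
      ∑< (suc w) term + 0             ≡⟨ cong (∑< (suc w) term +_) (trans (cong (w *_) (binom-vanishes v w (n<1+n v))) (*-zeroʳ w)) ⟨
      ∑< (suc w) term + w * binom v w ≡⟨ partial-sum w (≤-trans (⌊n/2⌋≤n v) (n≤1+n v)) ⟩
      w * binom v h                   ∎

  open CentralExcess using (excess-central) public

  excess-double : ∀ n → excess (n + n) 0 0 ≡ n * binom (2 * n) n
  excess-double zero    = refl
  excess-double (suc m) = begin
    excess (suc (m + suc m)) 0 0                      ≡⟨ excess-central (m + suc m) ⟩
    suc (m + suc m) * binom (m + suc m) ⌊ m + suc m /2⌋ ≡⟨ cong (λ e → suc (m + suc m) * binom (m + suc m) e) (⌊m+[1+m]/2⌋≡m m) ⟩
    suc (m + suc m) * binom (m + suc m) m             ≡⟨ absorption (m + suc m) m ⟨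
    suc m * binom (suc (m + suc m)) (suc m)           ≡⟨ cong (λ e → suc m * binom (suc (m + e)) (suc m)) (+-identityʳ (suc m)) ⟨
    suc m * binom (2 * suc m) (suc m)                 ∎
    where
    ⌊m+[1+m]/2⌋≡m : ∀ m → ⌊ m + suc m /2⌋ ≡ m
    ⌊m+[1+m]/2⌋≡m zero    = refl
    ⌊m+[1+m]/2⌋≡m (suc m) = trans (cong (λ e → ⌊ suc e /2⌋) (+-suc m (suc m))) (cong suc (⌊m+[1+m]/2⌋≡m m))

module Indicators where

  open import Data.Bool using (true; false; if_then_else_)
  open import Data.Nat
  open import Data.Nat.Properties
  open import Data.List using (List; upTo)
  open import Relation.Binary.PropositionalEquality
  open import Relation.Nullary using (Dec; yes; no; ¬_; contradiction)
  open ≡-Reasoning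
  open FiniteSums

  𝟙[_≤_] : ℕ → ℕ → ℕ
  𝟙[ s ≤ t ] = if s ≤ᵇ t then 1 else 0

  𝟙[≤]-yes : ∀ {s t} → s ≤ t → 𝟙[ s ≤ t ] ≡ 1
  𝟙[≤]-yes {s} {t} s≤t with s ≤ᵇ t | ≤⇒≤ᵇ s≤t
  ... | true | _ = refl

  𝟙[≤]-no : ∀ {s t} → ¬ s ≤ t → 𝟙[ s ≤ t ] ≡ 0
  𝟙[≤]-no {s} {t} s≰t with s ≤ᵇ t | ≤ᵇ⇒≤ s t
  ... | false | _       = refl
  ... | true  | ≤ᵇ⇒s≤t = contradiction (≤ᵇ⇒s≤t _) s≰t

  ∑-𝟙[≤] : ∀ K s → ∑ (upTo K) (λ t → 𝟙[ s ≤ t ]) ≡ K ∸ s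
  ∑-𝟙[≤] zero    s = sym (0∸n≡0 s)
  ∑-𝟙[≤] (suc K) s = trans (∑-upTo-suc K (λ t → 𝟙[ s ≤ t ])) (trans (cong (_+ 𝟙[ s ≤ K ]) (∑-𝟙[≤] K s)) (last (s ≤? K)))
    where
    last : Dec (s ≤ K) → (K ∸ s) + 𝟙[ s ≤ K ] ≡ suc K ∸ s
    last (yes s≤K) = trans (cong ((K ∸ s) +_) (𝟙[≤]-yes s≤K)) (trans (+-comm (K ∸ s) 1) (sym (+-∸-assoc 1 s≤K)))
    last (no s≰K)  = trans (cong₂ _+_ (m≤n⇒m∸n≡0 (<⇒≤ (≰⇒> s≰K))) (𝟙[≤]-no s≰K)) (sym (m≤n⇒m∸n≡0 (≰⇒> s≰K)))

  𝟙[≤]-* : ∀ p q t → 𝟙[ p ≤ t ] * 𝟙[ q ≤ t ] ≡ 𝟙[ p ⊔ q ≤ t ]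
  𝟙[≤]-* p q t with p ≤? t | q ≤? t
  ... | yes p≤t | yes q≤t rewrite 𝟙[≤]-yes p≤t | 𝟙[≤]-yes q≤t | 𝟙[≤]-yes (⊔-lub p≤t q≤t) = refl
  ... | yes p≤t | no q≰t  rewrite 𝟙[≤]-yes p≤t | 𝟙[≤]-no q≰t | 𝟙[≤]-no (λ p⊔q≤t → q≰t (≤-trans (m≤n⊔m p q) p⊔q≤t)) = refl
  ... | no p≰t  | _       rewrite 𝟙[≤]-no p≰t | 𝟙[≤]-no (λ p⊔q≤t → p≰t (≤-trans (m≤m⊔n p q) p⊔q≤t)) = refl

  ∸-⊔ : ∀ K p q → q ≤ K → (K ∸ (p ⊔ q)) + (q ∸ p) ≡ K ∸ p
  ∸-⊔ K p q q≤K with p ≤? q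
  ... | yes p≤q rewrite m≤n⇒m⊔n≡n p≤q = begin
    (K ∸ q) + (q ∸ p) ≡⟨ +-∸-assoc (K ∸ q) p≤q ⟨
    ((K ∸ q) + q) ∸ p ≡⟨ cong (_∸ p) (m∸n+n≡m q≤K) ⟩
    K ∸ p             ∎
  ... | no p≰q rewrite m≥n⇒m⊔n≡m (<⇒≤ (≰⇒> p≰q)) | m≤n⇒m∸n≡0 (<⇒≤ (≰⇒> p≰q)) = +-identityʳ (K ∸ p)

  layer-cake : ∀ K p q → q ≤ K →
    ∑ (upTo K) (λ t → 𝟙[ p ≤ t ]) ≡ ∑ (upTo K) (λ t → 𝟙[ p ≤ t ] * 𝟙[ q ≤ t ]) + (q ∸ p)
  layer-cake K p q q≤K = begin
    ∑ (upTo K) (λ t → 𝟙[ p ≤ t ])                     ≡⟨ ∑-𝟙[≤] K p ⟩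
    K ∸ p                                           ≡⟨ ∸-⊔ K p q q≤K ⟨
    (K ∸ (p ⊔ q)) + (q ∸ p)                          ≡⟨ cong (_+ (q ∸ p)) (∑-𝟙[≤] K (p ⊔ q)) ⟨
    ∑ (upTo K) (λ t → 𝟙[ p ⊔ q ≤ t ]) + (q ∸ p)         ≡⟨ cong (_+ (q ∸ p)) (∑-cong (upTo K) (λ t → 𝟙[≤]-* p q t)) ⟨
    ∑ (upTo K) (λ t → 𝟙[ p ≤ t ] * 𝟙[ q ≤ t ]) + (q ∸ p) ∎

  ∑-layer-cake : ∀ n {X : Set} (L : List X) (p q : X → ℕ) → (∀ x → q x ≤ n) →
    ∑ (upTo (suc n)) (λ t → ∑ L (λ x → 𝟙[ p x ≤ t ])) ≡
    ∑ (upTo (suc n)) (λ t → ∑ L (λ x → 𝟙[ p x ≤ t ] * 𝟙[ q x ≤ t ])) + ∑ L (λ x → q x ∸ p x)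
  ∑-layer-cake n L p q q≤n = begin
    ∑ ts (λ t → ∑ L (λ x → 𝟙[ p x ≤ t ]))
      ≡⟨ ∑-swap ts L (λ t x → 𝟙[ p x ≤ t ]) ⟩
    ∑ L (λ x → ∑ ts (λ t → 𝟙[ p x ≤ t ]))
      ≡⟨ ∑-cong L (λ x → layer-cake (suc n) (p x) (q x) (m≤n⇒m≤1+n (q≤n x))) ⟩
    ∑ L (λ x → ∑ ts (λ t → 𝟙[ p x ≤ t ] * 𝟙[ q x ≤ t ]) + (q x ∸ p x))
      ≡⟨ ∑-+ L _ _ ⟩
    ∑ L (λ x → ∑ ts (λ t → 𝟙[ p x ≤ t ] * 𝟙[ q x ≤ t ])) + ∑ L (λ x → q x ∸ p x)
      ≡⟨ cong (_+ ∑ L (λ x → q x ∸ p x)) (∑-swap L ts (λ x t → 𝟙[ p x ≤ t ] * 𝟙[ q x ≤ t ])) ⟩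
    ∑ ts (λ t → ∑ L (λ x → 𝟙[ p x ≤ t ] * 𝟙[ q x ≤ t ])) + ∑ L (λ x → q x ∸ p x) ∎
    where
    ts : List ℕ
    ts = upTo (suc n)

  𝟙[_≡_] : ℕ → ℕ → ℕ
  𝟙[ d ≡ w ] = if d ≡ᵇ w then 1 else 0

  𝟙[≡]-refl : ∀ d → 𝟙[ d ≡ d ] ≡ 1
  𝟙[≡]-refl d with d ≡ᵇ d | ≡⇒≡ᵇ d d refl
  ... | true | _ = refl

  𝟙[≡]-no : ∀ {d w} → d ≢ w → 𝟙[ d ≡ w ] ≡ 0
  𝟙[≡]-no {d} {w} d≢w with d ≡ᵇ w | ≡ᵇ⇒≡ d w
  ... | false | _       = refl
  ... | true  | ≡ᵇ⇒d≡w = contradiction (≡ᵇ⇒d≡w _) d≢w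

  ∑-𝟙[≡]-below : ∀ K d (f : ℕ → ℕ) → K ≤ d → ∑ (upTo K) (λ w → 𝟙[ d ≡ w ] * f w) ≡ 0
  ∑-𝟙[≡]-below zero    d f _     = refl
  ∑-𝟙[≡]-below (suc K) d f 1+K≤d = trans (∑-upTo-suc K _)
    (cong₂ _+_ (∑-𝟙[≡]-below K d f (≤-trans (n≤1+n K) 1+K≤d)) (cong (_* f K) (𝟙[≡]-no (λ d≡K → <-irrefl (sym d≡K) 1+K≤d))))

  ∑-𝟙[≡] : ∀ K d (f : ℕ → ℕ) → d < K → ∑ (upTo K) (λ w → 𝟙[ d ≡ w ] * f w) ≡ f d
  ∑-𝟙[≡] (suc K) d f d<1+K with d ≟ K
  ... | yes refl = trans (∑-upTo-suc K _) (trans (cong₂ _+_ (∑-𝟙[≡]-below K d f ≤-refl) (cong (_* f d) (𝟙[≡]-refl d))) (+-identityʳ (f d)))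
  ... | no d≢K   = trans (∑-upTo-suc K _) (trans (cong₂ _+_ (∑-𝟙[≡] K d f (≤∧≢⇒< (≤-pred d<1+K) d≢K)) (cong (_* f K) (𝟙[≡]-no d≢K))) (+-identityʳ (f d)))

module CubeExcess where

  open import Data.Bool using (Bool; true; false; if_then_else_; _xor_)
  open import Data.Nat
  open import Data.Nat.Properties
  open import Data.Nat.Tactic.RingSolver using (solve-∀)
  open import Data.Vec using (Vec; []; _∷_)
  open import Relation.Binary.PropositionalEquality
  open ≡-Reasoning
  open FiniteSums
  open Hypercube
  open Binomials
  open import Defs using (hamming; allVecs)

  excessSum : ∀ n (a b : Vec Bool n) → ℕ → ℕ → ℕ
  excessSum n a b p q = ∑cube n (λ u → (q + hamming b u) ∸ (p + hamming a u))

  excessSum-face : ∀ n a₀ b₀ (a b : Vec Bool n) p q c →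
    ∑cube n (λ u → (q + hamming (b₀ ∷ b) (c ∷ u)) ∸ (p + hamming (a₀ ∷ a) (c ∷ u))) ≡
    excessSum n a b ((if a₀ xor c then 1 else 0) + p) ((if b₀ xor c then 1 else 0) + q)
  excessSum-face n a₀ b₀ a b p q c =
    ∑-cong (allVecs n) (λ u → cong₂ _∸_ (move q (if b₀ xor c then 1 else 0) (hamming b u))
                                          (move p (if a₀ xor c then 1 else 0) (hamming a u)))
    where
    move : ∀ x δ h → x + (δ + h) ≡ (δ + x) + h
    move = solve-∀

  excessSum≡excess : ∀ n (a b : Vec Bool n) p q →
    excessSum n a b p q ≡ 2 ^ (n ∸ hamming a b) * excess (hamming a b) p q
  excessSum≡excess zero    []       []       p q = cong (_+ 0) (cong₂ _∸_ (+-identityʳ q) (+-identityʳ p))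
  excessSum≡excess (suc n) (a₀ ∷ a) (b₀ ∷ b) p q = begin
    excessSum (suc n) (a₀ ∷ a) (b₀ ∷ b) p q
      ≡⟨ ∑cube-split n _ ⟩
    face false + face true
      ≡⟨ cong₂ _+_ (excessSum-face n a₀ b₀ a b p q false) (excessSum-face n a₀ b₀ a b p q true) ⟩
    excessSum n a b (δ a₀ false + p) (δ b₀ false + q) + excessSum n a b (δ a₀ true + p) (δ b₀ true + q)
      ≡⟨ by-bits a₀ b₀ ⟩
    2 ^ (suc n ∸ hamming (a₀ ∷ a) (b₀ ∷ b)) * excess (hamming (a₀ ∷ a) (b₀ ∷ b)) p q ∎
    where
    face : Bool → ℕ
    face c = ∑cube n (λ u → (q + hamming (b₀ ∷ b) (c ∷ u)) ∸ (p + hamming (a₀ ∷ a) (c ∷ u)))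
    δ : Bool → Bool → ℕ
    δ x y = if x xor y then 1 else 0
    w e : ℕ
    w = hamming a b
    e = 2 ^ (n ∸ w)
    ih : ∀ p q → excessSum n a b p q ≡ e * excess w p q
    ih = excessSum≡excess n a b
    -- equal bits: both faces contribute the same; the exponent grows by one
    agree : e * excess w p q + e * excess w p q ≡ 2 ^ (suc n ∸ w) * excess w p q
    agree = trans (double e (excess w p q)) (cong (λ k → 2 ^ k * excess w p q) (sym (+-∸-assoc 1 (hamming-≤ a b))))
      where
      double : ∀ x y → x * y + x * y ≡ (2 * x) * y
      double = solve-∀
    by-bits : ∀ a₀ b₀ →
      excessSum n a b (δ a₀ false + p) (δ b₀ false + q) + excessSum n a b (δ a₀ true + p) (δ b₀ true + q) ≡
      2 ^ (suc n ∸ hamming (a₀ ∷ a) (b₀ ∷ b)) * excess (hamming (a₀ ∷ a) (b₀ ∷ b)) p q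
    by-bits false false = trans (cong₂ _+_ (ih p q) (trans (ih (suc p) (suc q)) (cong (e *_) (excess-shift w p q)))) agree
    by-bits true  true  = trans (cong₂ _+_ (trans (ih (suc p) (suc q)) (cong (e *_) (excess-shift w p q))) (ih p q)) agree
    by-bits false true  = trans (cong₂ _+_ (ih p (suc q)) (ih (suc p) q))
                                (trans (+-comm (e * excess w p (suc q)) _) (sym (*-distribˡ-+ e (excess w (suc p) q) (excess w p (suc q)))))
    by-bits true  false = trans (cong₂ _+_ (ih (suc p) q) (ih p (suc q))) (sym (*-distribˡ-+ e (excess w (suc p) q) (excess w p (suc q))))

  weightExcess : ∀ n → ℕ → ℕ → ℕ
  weightExcess n p q = ∑cube n (λ u → ∑cube n (λ v → (q + weight v) ∸ (p + weight u)))

  ∑cube-weight-split : ∀ n q x → ∑cube (suc n) (λ v → (q + weight v) ∸ x) ≡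
    ∑cube n (λ v → (q + weight v) ∸ x) + ∑cube n (λ v → (suc q + weight v) ∸ x)
  ∑cube-weight-split n q x =
    trans (∑cube-split n _) (cong (∑cube n (λ v → (q + weight v) ∸ x) +_) (∑-cong (allVecs n) (λ v → cong (_∸ x) (+-suc q (weight v)))))

  weightExcess-split : ∀ n p q → weightExcess (suc n) p q ≡
    (weightExcess n p q + weightExcess n p (suc q)) + (weightExcess n (suc p) q + weightExcess n (suc p) (suc q))
  weightExcess-split n p q = begin
    weightExcess (suc n) p q
      ≡⟨ ∑cube-split n _ ⟩
    ∑cube n (λ u → inner (p + weight u)) + ∑cube n (λ u → inner (p + suc (weight u)))
      ≡⟨ cong (∑cube n (λ u → inner (p + weight u)) +_) (∑-cong (allVecs n) (λ u → cong inner (+-suc p (weight u)))) ⟩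
    ∑cube n (λ u → inner (p + weight u)) + ∑cube n (λ u → inner (suc p + weight u))
      ≡⟨ cong₂ _+_ (trans (∑-cong (allVecs n) (λ u → ∑cube-weight-split n q (p + weight u))) (∑-+ (allVecs n) _ _))
                   (trans (∑-cong (allVecs n) (λ u → ∑cube-weight-split n q (suc p + weight u))) (∑-+ (allVecs n) _ _)) ⟩
    (weightExcess n p q + weightExcess n p (suc q)) + (weightExcess n (suc p) q + weightExcess n (suc p) (suc q)) ∎
    where
    inner : ℕ → ℕ
    inner x = ∑cube (suc n) (λ v → (q + weight v) ∸ x)

  double-∸ : ∀ x y → (x ∸ y) + (x ∸ y) ≡ (x + x) ∸ (y + y)
  double-∸ zero    y       = trans (cong₂ _+_ (0∸n≡0 y) (0∸n≡0 y)) (sym (0∸n≡0 (y + y)))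
  double-∸ (suc x) zero    = refl
  double-∸ (suc x) (suc y) = trans (double-∸ x y) (sym (cong₂ _∸_ (+-suc x x) (+-suc y y)))

  weightExcess-double : ∀ n p q → weightExcess n p q + weightExcess n p q ≡ excess (n + n) (p + p) (q + q)
  weightExcess-double zero p q = trans (cong (λ e → e + e) in-dimension-0) (double-∸ q p)
    where
    in-dimension-0 : weightExcess zero p q ≡ q ∸ p
    in-dimension-0 = trans (+-identityʳ _) (trans (+-identityʳ _) (cong₂ _∸_ (+-identityʳ q) (+-identityʳ p)))
  weightExcess-double (suc n) p q = begin
    weightExcess (suc n) p q + weightExcess (suc n) p q
      ≡⟨ cong (λ e → e + e) (weightExcess-split n p q) ⟩
    (W p q + W p (suc q) + (W (suc p) q + W (suc p) (suc q))) + (W p q + W p (suc q) + (W (suc p) q + W (suc p) (suc q)))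
      ≡⟨ pair-up (W p q) (W p (suc q)) (W (suc p) q) (W (suc p) (suc q)) ⟩
    (W p q + W p q) + (W p (suc q) + W p (suc q)) + (W (suc p) q + W (suc p) q) + (W (suc p) (suc q) + W (suc p) (suc q))
      ≡⟨ cong₂ _+_ (cong₂ _+_ (cong₂ _+_ (weightExcess-double n p q) (weightExcess-double n p (suc q))) (weightExcess-double n (suc p) q))
                   (weightExcess-double n (suc p) (suc q)) ⟩
    X P Q + X P (suc q + suc q) + X (suc p + suc p) Q + X (suc p + suc p) (suc q + suc q)
      ≡⟨ cong₂ _+_ (cong₂ _+_ (cong (X P Q +_) (cong (X P) 2+Q)) (cong (λ e → X e Q) 2+P))
                   (trans (cong₂ X 2+P 2+Q) (trans (excess-shift m (suc P) (suc Q)) (excess-shift m P Q))) ⟩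
    X P Q + X P (2 + Q) + X (2 + P) Q + X P Q
      ≡⟨ rearrange (X P Q) (X P (2 + Q)) (X (2 + P) Q) ⟩
    (X (2 + P) Q + X P Q) + (X P Q + X P (2 + Q))
      ≡⟨ cong₂ _+_ (cong (X (2 + P) Q +_) (sym (excess-shift m P Q))) (cong (_+ X P (2 + Q)) (sym (excess-shift m P Q))) ⟩
    excess (2 + m) P Q
      ≡⟨ cong (λ k → excess (suc k) P Q) (sym (+-suc n n)) ⟩
    excess (suc n + suc n) (p + p) (q + q) ∎
    where
    m P Q : ℕ
    m = n + n
    P = p + p
    Q = q + q
    W X : ℕ → ℕ → ℕ
    W = weightExcess n
    X = excess m
    2+P : suc p + suc p ≡ 2 + P
    2+P = cong suc (+-suc p p)
    2+Q : suc q + suc q ≡ 2 + Q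
    2+Q = cong suc (+-suc q q)
    pair-up : ∀ a b c d → (a + b + (c + d)) + (a + b + (c + d)) ≡ (a + a) + (b + b) + (c + c) + (d + d)
    pair-up = solve-∀
    rearrange : ∀ a b c → a + b + c + a ≡ (c + a) + (a + b)
    rearrange = solve-∀

module Balls (n : ℕ) where

  open import Data.Bool using (Bool)
  open import Data.Nat
  open import Data.Nat.Properties
  open import Data.Nat.Combinatorics using (_C_)
  open import Data.Vec using (Vec)
  open import Data.List using (List; upTo)
  open import Relation.Binary.PropositionalEquality
  open ≡-Reasoning
  open import Defs using (hamming; allVecs; indB; ballSize; lam)
  open FiniteSums
  open Hypercube
  open Binomials
  open Indicators
  open CubeExcess

  -- λ(0) = 0, so the pairs (zᵢ,zᵢ) do not contribute.
  lam-0 : lam n 0 ≡ 0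
  lam-0 = cong (_* (0 C 0)) (*-zeroʳ (2 ^ n))

  excess-lam : ∀ w → 2 ^ (n ∸ w) * excess w 0 0 ≡ lam n w
  excess-lam zero    = trans (*-zeroʳ (2 ^ n)) (sym lam-0)
  excess-lam (suc v) = begin
    2 ^ (n ∸ suc v) * excess (suc v) 0 0            ≡⟨ cong (2 ^ (n ∸ suc v) *_) (excess-central v) ⟩
    2 ^ (n ∸ suc v) * (suc v * binom v ⌊ v /2⌋)      ≡⟨ *-assoc (2 ^ (n ∸ suc v)) (suc v) _ ⟨
    2 ^ (n ∸ suc v) * suc v * binom v ⌊ v /2⌋        ≡⟨ cong (2 ^ (n ∸ suc v) * suc v *_) (binom≡C v ⌊ v /2⌋) ⟩
    lam n (suc v)                                   ∎

  thresholds : List ℕ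
  thresholds = upTo (suc n)

  cube : List (Vec Bool n)
  cube = allVecs n

  vol : ℕ → ℕ
  vol t = ballSize (zeros n) t

  ballSize≡vol : ∀ x t → ballSize x t ≡ vol t
  ballSize≡vol x t = ∑cube-radial n (λ k → 𝟙[ k ≤ t ]) x (zeros n)

  F₁ F₂ : ℕ
  F₁ = ∑ thresholds vol
  F₂ = ∑ thresholds (λ t → vol t * vol t)

  overlaps : Vec Bool n → Vec Bool n → ℕ
  overlaps a b = ∑ thresholds (λ t → ∑ cube (λ x → indB x t a * indB x t b))

  -- By the layer cake, ∑_t (|B(a,t)| − |B(a,t) ∩ B(b,t)|) = ∑_x (d(b,x) ∸ d(a,x)),
  -- and that sum is 2^(n−w)·excess w 0 0 = λ(w).
  overlaps+lam : ∀ a b → overlaps a b + lam n (hamming a b) ≡ F₁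
  overlaps+lam a b = begin
    overlaps a b + lam n (hamming a b)
      ≡⟨ cong₂ _+_ (∑-cong thresholds (λ t → ∑-cong cube (λ x → cong₂ (λ p q → 𝟙[ p ≤ t ] * 𝟙[ q ≤ t ]) (hamming-sym x a) (hamming-sym x b))))
                   (sym (trans (excessSum≡excess n a b 0 0) (excess-lam (hamming a b)))) ⟩
    ∑ thresholds (λ t → ∑ cube (λ x → 𝟙[ hamming a x ≤ t ] * 𝟙[ hamming b x ≤ t ])) + excessSum n a b 0 0
      ≡⟨ ∑-layer-cake n cube (hamming a) (hamming b) (hamming-≤ b) ⟨
    ∑ thresholds (λ t → ballSize a t)
      ≡⟨ ∑-cong thresholds (ballSize≡vol a) ⟩
    F₁ ∎

  volume-layer-cake : 2 ^ n * F₁ ≡ F₂ + weightExcess n 0 0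
  volume-layer-cake = begin
    2 ^ n * F₁
      ≡⟨ ∑-*ˡ thresholds (2 ^ n) vol ⟨
    ∑ thresholds (λ t → 2 ^ n * vol t)
      ≡⟨ ∑-cong thresholds copies ⟩
    ∑ thresholds (λ t → ∑ cube (λ u → ∑ cube (λ v → 𝟙[ weight u ≤ t ])))
      ≡⟨ ∑-swap thresholds cube _ ⟩
    ∑ cube (λ u → ∑ thresholds (λ t → ∑ cube (λ v → 𝟙[ weight u ≤ t ])))
      ≡⟨ ∑-cong cube (λ u → ∑-layer-cake n cube (λ _ → weight u) weight (hamming-≤ (zeros n))) ⟩
    ∑ cube (λ u → ∑ thresholds (λ t → ∑ cube (λ v → 𝟙[ weight u ≤ t ] * 𝟙[ weight v ≤ t ])) + ∑ cube (λ v → weight v ∸ weight u))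
      ≡⟨ ∑-+ cube _ _ ⟩
    ∑ cube (λ u → ∑ thresholds (λ t → ∑ cube (λ v → 𝟙[ weight u ≤ t ] * 𝟙[ weight v ≤ t ]))) + weightExcess n 0 0
      ≡⟨ cong (_+ weightExcess n 0 0) (trans (∑-swap cube thresholds _) (∑-cong thresholds square)) ⟩
    F₂ + weightExcess n 0 0 ∎
    where
    copies : ∀ t → 2 ^ n * vol t ≡ ∑ cube (λ u → ∑ cube (λ v → 𝟙[ weight u ≤ t ]))
    copies t = sym (trans (∑-cong cube (λ u → ∑cube-const n 𝟙[ weight u ≤ t ])) (∑-*ˡ cube (2 ^ n) (λ u → 𝟙[ weight u ≤ t ])))
    square : ∀ t → ∑ cube (λ u → ∑ cube (λ v → 𝟙[ weight u ≤ t ] * 𝟙[ weight v ≤ t ])) ≡ vol t * vol t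
    square t = trans (∑-cong cube (λ u → ∑-*ˡ cube 𝟙[ weight u ≤ t ] (λ v → 𝟙[ weight v ≤ t ])))
                     (∑-*ʳ cube (vol t) (λ u → 𝟙[ weight u ≤ t ]))

  -- Twice the above, with 2·∑_{u,v} (|v| ∸ |u|) = excess (2n) 0 0 = n·C(2n,n).
  volume-identity : 2 ^ n * F₁ + 2 ^ n * F₁ ≡ (F₂ + F₂) + n * ((2 * n) C n)
  volume-identity = begin
    2 ^ n * F₁ + 2 ^ n * F₁ ≡⟨ cong (λ e → e + e) volume-layer-cake ⟩
    (F₂ + P) + (F₂ + P)     ≡⟨ interchange F₂ P F₂ P ⟩
    (F₂ + F₂) + (P + P)     ≡⟨ cong ((F₂ + F₂) +_) (trans (weightExcess-double n 0 0) (trans (excess-double n) (cong (n *_) (binom≡C (2 * n) n)))) ⟩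
    (F₂ + F₂) + n * ((2 * n) C n) ∎
    where
    open import Algebra.Properties.CommutativeSemigroup +-commutativeSemigroup using (interchange)
    P : ℕ
    P = weightExcess n 0 0

module Configuration (n N : ℕ) (z : Fin N → Vec Bool n) where

  open import Data.Nat
  open import Data.Nat.Properties
  open import Data.List using (List; map; concatMap; upTo; allFin; applyUpTo)
  open import Data.List.Properties using (length-tabulate; map-applyUpTo)
  open import Data.Nat.Tactic.RingSolver using (solve-∀)
  open import Function using (id)
  open import Relation.Binary.PropositionalEquality
  open ≡-Reasoning
  open import Defs using (hamming; indB; ballSize; lam; sumℕ)
  open FiniteSums
  open Hypercube
  open Indicators
  open Balls n

  points : List (Fin N)
  points = allFin N

  ∑points-const : ∀ c → ∑ points (λ _ → c) ≡ N * c
  ∑points-const c = trans (∑-const points c) (cong (_* c) (length-tabulate {n = N} id))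

  count : Vec Bool n → ℕ → ℕ
  count x t = ∑ points (λ j → indB x t (z j))

  L : ℕ
  L = ∑ points (λ i → ∑ points (λ j → lam n (hamming (z i) (z j))))

  Σcount² Σball² Σball·count : ℕ
  Σcount²     = ∑ thresholds (λ t → ∑ cube (λ x → count x t * count x t))
  Σball²      = ∑ thresholds (λ t → ∑ cube (λ x → ballSize x t * ballSize x t))
  Σball·count = ∑ thresholds (λ t → ∑ cube (λ x → ballSize x t * count x t))

  Σcount²≡∑overlaps : Σcount² ≡ ∑ points (λ i → ∑ points (λ j → overlaps (z i) (z j)))
  Σcount²≡∑overlaps = begin
    Σcount²
      ≡⟨ ∑-cong thresholds (λ t → ∑-cong cube (λ x → square x t)) ⟩
    ∑ thresholds (λ t → ∑ cube (λ x → ∑ points (λ i → ∑ points (G t x i))))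
      ≡⟨ ∑-cong thresholds (λ t → trans (∑-swap cube points _) (∑-cong points (λ i → ∑-swap cube points (λ x j → G t x i j)))) ⟩
    ∑ thresholds (λ t → ∑ points (λ i → ∑ points (λ j → ∑ cube (λ x → G t x i j))))
      ≡⟨ ∑-swap thresholds points _ ⟩
    ∑ points (λ i → ∑ thresholds (λ t → ∑ points (λ j → ∑ cube (λ x → G t x i j))))
      ≡⟨ ∑-cong points (λ i → ∑-swap thresholds points _) ⟩
    ∑ points (λ i → ∑ points (λ j → overlaps (z i) (z j))) ∎
    where
    G : ℕ → Vec Bool n → Fin N → Fin N → ℕ
    G t x i j = indB x t (z i) * indB x t (z j)
    square : ∀ x t → count x t * count x t ≡ ∑ points (λ i → ∑ points (G t x i))
    square x t = trans (sym (∑-*ʳ points (count x t) (λ i → indB x t (z i))))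
                       (∑-cong points (λ i → sym (∑-*ˡ points (indB x t (z i)) (λ j → indB x t (z j)))))

  -- Every pair contributes overlaps + λ = F₁, so ∑_t ∑_x |Z ∩ B(x,t)|² + L = N²·F₁.
  Σcount²+L : Σcount² + L ≡ N * (N * F₁)
  Σcount²+L = begin
    Σcount² + L
      ≡⟨ cong (_+ L) Σcount²≡∑overlaps ⟩
    ∑ points (λ i → ∑ points (λ j → overlaps (z i) (z j))) + L
      ≡⟨ ∑-+ points _ _ ⟨
    ∑ points (λ i → ∑ points (λ j → overlaps (z i) (z j)) + ∑ points (λ j → lam n (hamming (z i) (z j))))
      ≡⟨ ∑-cong points (λ i → trans (sym (∑-+ points _ _)) (trans (∑-cong points (λ j → overlaps+lam (z i) (z j))) (∑points-const F₁))) ⟩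
    ∑ points (λ _ → N * F₁)
      ≡⟨ ∑points-const (N * F₁) ⟩
    N * (N * F₁) ∎

  -- All balls of radius t have volume |B_t|.
  Σball²≡2ⁿF₂ : Σball² ≡ 2 ^ n * F₂
  Σball²≡2ⁿF₂ = trans (∑-cong thresholds (λ t → trans (∑-cong cube (λ x → cong₂ _*_ (ballSize≡vol x t) (ballSize≡vol x t)))
                                                   (∑cube-const n (vol t * vol t))))
                  (∑-*ˡ thresholds (2 ^ n) (λ t → vol t * vol t))

  -- Each point of Z lies in exactly |B_t| balls of radius t.
  Σball·count≡NF₂ : Σball·count ≡ N * F₂
  Σball·count≡NF₂ = trans (∑-cong thresholds per-radius) (∑-*ˡ thresholds N (λ t → vol t * vol t))
    where
    per-radius : ∀ t → ∑ cube (λ x → ballSize x t * count x t) ≡ N * (vol t * vol t)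
    per-radius t = begin
      ∑ cube (λ x → ballSize x t * count x t)          ≡⟨ ∑-cong cube (λ x → cong (_* count x t) (ballSize≡vol x t)) ⟩
      ∑ cube (λ x → vol t * count x t)                ≡⟨ ∑-*ˡ cube (vol t) (λ x → count x t) ⟩
      vol t * ∑ cube (λ x → count x t)                ≡⟨ cong (vol t *_) (∑-swap cube points (λ x j → indB x t (z j))) ⟩
      vol t * ∑ points (λ j → ∑ cube (λ x → indB x t (z j)))
        ≡⟨ cong (vol t *_) (∑-cong points (λ j → trans (∑-cong cube (λ x → cong (λ p → 𝟙[ p ≤ t ]) (hamming-sym x (z j)))) (ballSize≡vol (z j) t))) ⟩
      vol t * ∑ points (λ _ → vol t)                  ≡⟨ cong (vol t *_) (∑points-const (vol t)) ⟩
      vol t * (N * vol t)                             ≡⟨ x[yx]≡y[xx] (vol t) N ⟩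
      N * (vol t * vol t)                             ∎
      where
      x[yx]≡y[xx] : ∀ x y → x * (y * x) ≡ y * (x * x)
      x[yx]≡y[xx] = solve-∀

  -- N·A_w: the number of ordered pairs of points of Z at distance w.
  pairsAt : ℕ → ℕ
  pairsAt w = sumℕ (concatMap (λ i → map (λ j → 𝟙[ hamming (z i) (z j) ≡ w ]) points) points)

  -- Weighting the distance distribution by λ recovers L; the term w = 0 is
  -- absent from the sum but λ(0) = 0.
  ∑pairsAt·lam : ∑ (map suc (upTo n)) (λ w → pairsAt w * lam n w) ≡ L
  ∑pairsAt·lam = begin
    ∑ (map suc (upTo n)) (λ w → pairsAt w * lam n w)
      ≡⟨ ∑-cong (map suc (upTo n)) (λ w → trans (cong (_* lam n w) (∑-concatMap points points (λ i j → 𝟙[ hamming (z i) (z j) ≡ w ])))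
                                         (trans (sym (∑-*ʳ points (lam n w) _)) (∑-cong points (λ i → sym (∑-*ʳ points (lam n w) _))))) ⟩
    ∑ (map suc (upTo n)) (λ w → ∑ points (λ i → ∑ points (λ j → 𝟙[ hamming (z i) (z j) ≡ w ] * lam n w)))
      ≡⟨ ∑-swap (map suc (upTo n)) points _ ⟩
    ∑ points (λ i → ∑ (map suc (upTo n)) (λ w → ∑ points (λ j → 𝟙[ hamming (z i) (z j) ≡ w ] * lam n w)))
      ≡⟨ ∑-cong points (λ i → trans (∑-swap (map suc (upTo n)) points _) (∑-cong points (λ j → select (hamming (z i) (z j)) (hamming-≤ (z i) (z j))))) ⟩
    L ∎
    where
    select : ∀ d → d ≤ n → ∑ (map suc (upTo n)) (λ w → 𝟙[ d ≡ w ] * lam n w) ≡ lam n d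
    select d d≤n = begin
      ∑ (map suc (upTo n)) f                ≡⟨ cong (λ l → sumℕ (map f l)) (map-applyUpTo id suc n) ⟩
      sumℕ (map f (applyUpTo suc n))        ≡⟨ cong (_+ sumℕ (map f (applyUpTo suc n))) (trans (cong (𝟙[ d ≡ 0 ] *_) lam-0) (*-zeroʳ 𝟙[ d ≡ 0 ])) ⟨
      f 0 + sumℕ (map f (applyUpTo suc n))  ≡⟨ ∑-𝟙[≡] (suc n) d (lam n) (s≤s d≤n) ⟩
      lam n d                               ∎
      where
      f : ℕ → ℕ
      f w = 𝟙[ d ≡ w ] * lam n w

-- The embedding ι : ℕ → ℚ, k ↦ k/1, and how the fractions k/d of the
-- definitions decompose through it. All facts are checked in ℚᵘ, where
-- equality of fractions is cross-multiplication in ℤ.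
module NatEmbedding where

  open import Data.Nat as ℕ using (ℕ; suc; NonZero)
  open import Data.Integer as ℤ using (+_)
  open import Data.Integer.Properties using (*-identityʳ; *-identityˡ)
  open import Data.Nat.Properties using () renaming (*-identityˡ to ℕ-*-identityˡ; *-identityʳ to ℕ-*-identityʳ)
  open import Data.Rational using (ℚ; 1ℚ; _+_; _*_; _/_; toℚᵘ)
  open import Data.Rational.Properties using (toℚᵘ-injective; toℚᵘ-fromℚᵘ; toℚᵘ-homo-*; toℚᵘ-homo-+)
  import Data.Rational.Unnormalised as U
  open import Data.Rational.Unnormalised.Properties using (≃-trans; ≃-sym; *-cong; +-cong)
  open import Relation.Binary.PropositionalEquality

  ι : ℕ → ℚ
  ι k = (+ k) / 1

  toℚᵘ-/ : ∀ i d → U._≃_ (toℚᵘ (i / suc d)) (U.mkℚᵘ i d)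
  toℚᵘ-/ i d = toℚᵘ-fromℚᵘ (U.mkℚᵘ i d)

  /≡ι* : ∀ k d .{{_ : NonZero d}} → (+ k) / d ≡ ι k * ((+ 1) / d)
  /≡ι* k (suc d) = toℚᵘ-injective (≃-trans (toℚᵘ-/ (+ k) d)
    (≃-sym (≃-trans (toℚᵘ-homo-* (ι k) ((+ 1) / suc d)) (≃-trans (*-cong (toℚᵘ-/ (+ k) 0) (toℚᵘ-/ (+ 1) d)) (U.*≡* cross)))))
    where
    cross : (+ k ℤ.* + 1) ℤ.* (+ suc d) ≡ (+ k) ℤ.* (+ (1 ℕ.* suc d))
    cross rewrite *-identityʳ (+ k) | ℕ-*-identityˡ (suc d) = refl

  ι-+ : ∀ a b → ι (a ℕ.+ b) ≡ ι a + ι b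
  ι-+ a b = toℚᵘ-injective (≃-trans (toℚᵘ-/ (+ (a ℕ.+ b)) 0)
    (≃-sym (≃-trans (toℚᵘ-homo-+ (ι a) (ι b)) (≃-trans (+-cong (toℚᵘ-/ (+ a) 0) (toℚᵘ-/ (+ b) 0)) (U.*≡* cross)))))
    where
    cross : ((+ a) ℤ.* (+ 1) ℤ.+ (+ b) ℤ.* (+ 1)) ℤ.* (+ 1) ≡ (+ (a ℕ.+ b)) ℤ.* (+ (1 ℕ.* 1))
    cross rewrite *-identityʳ (+ a) | *-identityʳ (+ b) | *-identityʳ (+ a ℤ.+ + b) = refl

  ι-* : ∀ a b → ι (a ℕ.* b) ≡ ι a * ι b
  ι-* a b = toℚᵘ-injective (≃-trans (toℚᵘ-/ (+ (a ℕ.* b)) 0)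
    (≃-sym (≃-trans (toℚᵘ-homo-* (ι a) (ι b)) (≃-trans (*-cong (toℚᵘ-/ (+ a) 0) (toℚᵘ-/ (+ b) 0)) (U.*≡* cross)))))
    where
    cross : ((+ a) ℤ.* (+ b)) ℤ.* (+ 1) ≡ (+ (a ℕ.* b)) ℤ.* (+ (1 ℕ.* 1))
    cross rewrite *-identityʳ (+ a ℤ.* + b) | ℕ-*-identityʳ (a ℕ.* b) = refl

  ι-inverse : ∀ d .{{_ : NonZero d}} → ι d * ((+ 1) / d) ≡ 1ℚ
  ι-inverse (suc d) = toℚᵘ-injective (≃-trans (toℚᵘ-homo-* (ι (suc d)) ((+ 1) / suc d))
    (≃-trans (*-cong (toℚᵘ-/ (+ suc d) 0) (toℚᵘ-/ (+ 1) d)) (U.*≡* cross)))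
    where
    cross : ((+ suc d) ℤ.* (+ 1)) ℤ.* (+ 1) ≡ (+ 1) ℤ.* (+ (1 ℕ.* suc d))
    cross = trans (*-identityʳ ((+ suc d) ℤ.* (+ 1))) (trans (*-identityʳ (+ suc d))
              (sym (trans (*-identityˡ (+ (1 ℕ.* suc d))) (cong +_ (ℕ-*-identityˡ (suc d))))))

module RationalSums where

  open import Data.Nat as ℕ using (ℕ)
  open import Data.List using (List; []; _∷_; map)
  open import Data.Rational using (ℚ; 0ℚ; _+_; _-_; _*_)
  open import Data.Rational.Solver using (module +-*-Solver)
  open import Relation.Binary.PropositionalEquality
  open ≡-Reasoning
  open import Defs using (sumℚ)
  open FiniteSums
  open NatEmbedding
  open +-*-Solver

  private variable
    X : Set

  ∑ℚ : List X → (X → ℚ) → ℚ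
  ∑ℚ L f = sumℚ (map f L)

  ∑ℚ-cong : ∀ (L : List X) {f g : X → ℚ} → (∀ x → f x ≡ g x) → ∑ℚ L f ≡ ∑ℚ L g
  ∑ℚ-cong []      f≗g = refl
  ∑ℚ-cong (x ∷ L) f≗g = cong₂ _+_ (f≗g x) (∑ℚ-cong L f≗g)

  ∑ℚ-linear : ∀ (L : List X) (α β γ : ℚ) (f g h : X → ℕ) →
    ∑ℚ L (λ x → α * ι (f x) + β * ι (g x) - γ * ι (h x)) ≡ α * ι (∑ L f) + β * ι (∑ L g) - γ * ι (∑ L h)
  ∑ℚ-linear []      α β γ f g h = solve 3 (λ α β γ → con 0ℚ := α :* con 0ℚ :+ β :* con 0ℚ :- γ :* con 0ℚ) refl α β γ
  ∑ℚ-linear (x ∷ L) α β γ f g h = begin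
    (α * ι (f x) + β * ι (g x) - γ * ι (h x)) + ∑ℚ L (λ x → α * ι (f x) + β * ι (g x) - γ * ι (h x))
      ≡⟨ cong ((α * ι (f x) + β * ι (g x) - γ * ι (h x)) +_) (∑ℚ-linear L α β γ f g h) ⟩
    (α * ι (f x) + β * ι (g x) - γ * ι (h x)) + (α * ι (∑ L f) + β * ι (∑ L g) - γ * ι (∑ L h))
      ≡⟨ solve 9 (λ α β γ a b c a′ b′ c′ → (α :* a :+ β :* b :- γ :* c) :+ (α :* a′ :+ β :* b′ :- γ :* c′)
                                        := α :* (a :+ a′) :+ β :* (b :+ b′) :- γ :* (c :+ c′))
                 refl α β γ (ι (f x)) (ι (g x)) (ι (h x)) (ι (∑ L f)) (ι (∑ L g)) (ι (∑ L h)) ⟩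
    α * (ι (f x) + ι (∑ L f)) + β * (ι (g x) + ι (∑ L g)) - γ * (ι (h x) + ι (∑ L h))
      ≡⟨ cong₂ _-_ (cong₂ _+_ (cong (α *_) (ι-+ (f x) _)) (cong (β *_) (ι-+ (g x) _))) (cong (γ *_) (ι-+ (h x) _)) ⟨
    α * ι (∑ (x ∷ L) f) + β * ι (∑ (x ∷ L) g) - γ * ι (∑ (x ∷ L) h) ∎

  ∑ℚ-scaled-product : ∀ (L : List X) (r : ℚ) (f g : X → ℕ) →
    ∑ℚ L (λ x → (ι (f x) * r) * ι (g x)) ≡ r * ι (∑ L (λ x → f x ℕ.* g x))
  ∑ℚ-scaled-product []      r f g = solve 1 (λ r → con 0ℚ := r :* con 0ℚ) refl r
  ∑ℚ-scaled-product (x ∷ L) r f g = begin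
    (ι (f x) * r) * ι (g x) + ∑ℚ L (λ x → (ι (f x) * r) * ι (g x))
      ≡⟨ cong ((ι (f x) * r) * ι (g x) +_) (∑ℚ-scaled-product L r f g) ⟩
    (ι (f x) * r) * ι (g x) + r * ι S
      ≡⟨ solve 4 (λ a r b s → (a :* r) :* b :+ r :* s := r :* (a :* b :+ s)) refl (ι (f x)) r (ι (g x)) (ι S) ⟩
    r * (ι (f x) * ι (g x) + ι S)
      ≡⟨ cong (r *_) (trans (ι-+ (f x ℕ.* g x) S) (cong (_+ ι S) (ι-* (f x) (g x)))) ⟨
    r * ι (f x ℕ.* g x ℕ.+ S) ∎
    where S = ∑ L (λ x → f x ℕ.* g x)

module FieldAlgebra where

  open import Data.Rational using (ℚ; 1ℚ; _+_; _-_; _*_)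
  open import Data.Rational.Solver using (module +-*-Solver)
  open import Relation.Binary.PropositionalEquality
  open ≡-Reasoning
  open +-*-Solver

  -- (c/N − b/2ⁿ)² with r = 1/N and m = 1/2ⁿ.
  square-expansion : ∀ c b r m →
    (c * r - b * m) * (c * r - b * m) ≡ (r * r) * (c * c) + (m * m) * (b * b) - (r * m + r * m) * (b * c)
  square-expansion = solve 4 (λ c b r m → (c :* r :- b :* m) :* (c :* r :- b :* m)
                                       := (r :* r) :* (c :* c) :+ (m :* m) :* (b :* b) :- (r :* m :+ r :* m) :* (b :* c)) refl

  +-to-- : ∀ x l y → x + l ≡ y → x ≡ y - l
  +-to-- x l y refl = solve 2 (λ x l → x := (x :+ l) :- l) refl x l

  half-inverse : ∀ m M h → m * M ≡ 1ℚ → (M + M) * h ≡ 1ℚ → m ≡ h + h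
  half-inverse m M h mM≡1 2Mh≡1 = begin
    m                               ≡⟨ solve 1 (λ m → m := m :* con 1ℚ) refl m ⟩
    m * 1ℚ                          ≡⟨ cong (m *_) 2Mh≡1 ⟨
    m * ((M + M) * h)               ≡⟨ solve 3 (λ m M h → m :* ((M :+ M) :* h) := (m :* M) :* (h :+ h)) refl m M h ⟩
    (m * M) * (h + h)               ≡⟨ cong (_* (h + h)) mM≡1 ⟩
    1ℚ * (h + h)                    ≡⟨ solve 1 (λ x → con 1ℚ :* x := x) refl (h + h) ⟩
    h + h                           ∎

  -- With r = 1/N, a = N, m = 1/2ⁿ, M = 2ⁿ, h = 1/2ⁿ⁺¹ and
  -- X, Y, Z the three sums of the expanded square, the relations between
  -- them turn r²X + m²Y − 2rmZ into k·h − r²·l.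
  closing-algebra : ∀ (r a m M h f b l X Y Z k : ℚ) →
    r * a ≡ 1ℚ → m * M ≡ 1ℚ → (M + M) * h ≡ 1ℚ →
    X + l ≡ a * (a * f) → Y ≡ M * b → Z ≡ a * b → k + (b + b) ≡ M * f + M * f →
    r * r * X + m * m * Y - (r * m + r * m) * Z ≡ k * h - r * (r * l)
  closing-algebra r a m M h f b l X Y Z k ra≡1 mM≡1 2Mh≡1 X+l≡ refl refl k+2b≡ = begin
    r * r * X + m * m * (M * b) - (r * m + r * m) * (a * b)
      ≡⟨ cong (λ x → r * r * x + m * m * (M * b) - (r * m + r * m) * (a * b)) (+-to-- X l _ X+l≡) ⟩
    r * r * (a * (a * f) - l) + m * m * (M * b) - (r * m + r * m) * (a * b)
      ≡⟨ solve 7 (λ r a m M f b l → r :* r :* (a :* (a :* f) :- l) :+ m :* m :* (M :* b) :- (r :* m :+ r :* m) :* (a :* b)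
                                 := (r :* a) :* (r :* a) :* f :+ (m :* M) :* m :* b :- ((r :* a) :* m :+ (r :* a) :* m) :* b :- r :* (r :* l))
                 refl r a m M f b l ⟩
    (r * a) * (r * a) * f + (m * M) * m * b - ((r * a) * m + (r * a) * m) * b - r * (r * l)
      ≡⟨ cong₂ (λ u v → u * u * f + v * m * b - (u * m + u * m) * b - r * (r * l)) ra≡1 mM≡1 ⟩
    1ℚ * 1ℚ * f + 1ℚ * m * b - (1ℚ * m + 1ℚ * m) * b - r * (r * l)
      ≡⟨ solve 4 (λ m f b s → con 1ℚ :* con 1ℚ :* f :+ con 1ℚ :* m :* b :- (con 1ℚ :* m :+ con 1ℚ :* m) :* b :- s
                           := con 1ℚ :* f :- b :* m :- s) refl m f b (r * (r * l)) ⟩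
    1ℚ * f - b * m - r * (r * l)
      ≡⟨ cong₂ (λ u v → u * f - b * v - r * (r * l)) 2Mh≡1 (sym (half-inverse m M h mM≡1 2Mh≡1)) ⟨
    (M + M) * h * f - b * (h + h) - r * (r * l)
      ≡⟨ solve 5 (λ M h f b s → (M :+ M) :* h :* f :- b :* (h :+ h) :- s := ((M :* f :+ M :* f) :- (b :+ b)) :* h :- s)
                 refl M h f b (r * (r * l)) ⟩
    ((M * f + M * f) - (b + b)) * h - r * (r * l)
      ≡⟨ cong (λ x → x * h - r * (r * l)) (+-to-- k (b + b) _ k+2b≡) ⟨
    k * h - r * (r * l) ∎

module Discrepancy (n N : ℕ) .{{_ : NonZero N}} (z : Fin N → Vec Bool n) where

  open import Data.Nat as ℕ using (suc)
  open import Data.Nat.Properties using (m^n≢0; +-identityʳ)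
  open import Data.Nat.Combinatorics using (_C_)
  open import Data.List using (map; upTo)
  open import Data.Integer using (+_)
  open import Data.Rational using (ℚ; 1ℚ; _+_; _-_; _*_; _/_)
  open import Data.Rational.Properties using (*-comm; +-comm)
  open import Relation.Binary.PropositionalEquality
  open ≡-Reasoning
  open import Defs using (DL2; A; Λ; lam; ballSize; sumℚ)
  open FiniteSums
  open NatEmbedding
  open RationalSums
  open FieldAlgebra
  open Balls n
  open Configuration n N z

  r m h : ℚ
  r = (+ 1) / N
  m = ((+ 1) / (2 ℕ.^ n)) {{m^n≢0 2 n}}
  h = ((+ 1) / (2 ℕ.^ suc n)) {{m^n≢0 2 (suc n)}}

  DL2-expansion : DL2 N z ≡ r * r * ι Σcount² + m * m * ι Σball² - (r * m + r * m) * ι Σball·count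
  DL2-expansion = begin
    DL2 N z
      ≡⟨ ∑ℚ-cong thresholds (λ t → ∑ℚ-cong cube (λ x → term x t)) ⟩
    ∑ℚ thresholds (λ t → ∑ℚ cube (λ x → r * r * ι (cc t x) + m * m * ι (bb t x) - (r * m + r * m) * ι (bc t x)))
      ≡⟨ ∑ℚ-cong thresholds (λ t → ∑ℚ-linear cube (r * r) (m * m) (r * m + r * m) (cc t) (bb t) (bc t)) ⟩
    ∑ℚ thresholds (λ t → r * r * ι (∑ cube (cc t)) + m * m * ι (∑ cube (bb t)) - (r * m + r * m) * ι (∑ cube (bc t)))
      ≡⟨ ∑ℚ-linear thresholds (r * r) (m * m) (r * m + r * m) (λ t → ∑ cube (cc t)) (λ t → ∑ cube (bb t)) (λ t → ∑ cube (bc t)) ⟩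
    r * r * ι Σcount² + m * m * ι Σball² - (r * m + r * m) * ι Σball·count ∎
    where
    cc bb bc : ℕ → Vec Bool n → ℕ
    cc t x = count x t ℕ.* count x t
    bb t x = ballSize x t ℕ.* ballSize x t
    bc t x = ballSize x t ℕ.* count x t
    deviation : Vec Bool n → ℕ → ℚ
    deviation x t = (+ count x t) / N - ((+ ballSize x t) / (2 ℕ.^ n)) {{m^n≢0 2 n}}
    term : ∀ x t → deviation x t * deviation x t ≡ r * r * ι (cc t x) + m * m * ι (bb t x) - (r * m + r * m) * ι (bc t x)
    term x t = begin
      deviation x t * deviation x t
        ≡⟨ cong₂ (λ u v → (u - v) * (u - v)) (/≡ι* (count x t) N) (/≡ι* (ballSize x t) (2 ℕ.^ n) {{m^n≢0 2 n}}) ⟩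
      (c * r - b * m) * (c * r - b * m)
        ≡⟨ square-expansion c b r m ⟩
      r * r * (c * c) + m * m * (b * b) - (r * m + r * m) * (b * c)
        ≡⟨ cong₂ _-_ (cong₂ _+_ (cong (r * r *_) (ι-* (count x t) (count x t))) (cong (m * m *_) (ι-* (ballSize x t) (ballSize x t))))
                     (cong ((r * m + r * m) *_) (ι-* (ballSize x t) (count x t))) ⟨
      r * r * ι (cc t x) + m * m * ι (bb t x) - (r * m + r * m) * ι (bc t x) ∎
      where
      c b : ℚ
      c = ι (count x t)
      b = ι (ballSize x t)

  r·N≡1 : r * ι N ≡ 1ℚ
  r·N≡1 = trans (*-comm r (ι N)) (ι-inverse N)

  m·2ⁿ≡1 : m * ι (2 ℕ.^ n) ≡ 1ℚ
  m·2ⁿ≡1 = trans (*-comm m (ι (2 ℕ.^ n))) (ι-inverse (2 ℕ.^ n) {{m^n≢0 2 n}})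

  2ⁿ⁺¹·h≡1 : (ι (2 ℕ.^ n) + ι (2 ℕ.^ n)) * h ≡ 1ℚ
  2ⁿ⁺¹·h≡1 = trans (cong (_* h) (sym (trans (ι-+ (2 ℕ.^ n) _) (cong (λ k → ι (2 ℕ.^ n) + ι k) (+-identityʳ (2 ℕ.^ n))))))
                    (ι-inverse (2 ℕ.^ suc n) {{m^n≢0 2 (suc n)}})

  Σcount²+L-ℚ : ι Σcount² + ι L ≡ ι N * (ι N * ι F₁)
  Σcount²+L-ℚ = trans (sym (ι-+ Σcount² L)) (trans (cong ι Σcount²+L) (trans (ι-* N (N ℕ.* F₁)) (cong (ι N *_) (ι-* N F₁))))

  Σball²-ℚ : ι Σball² ≡ ι (2 ℕ.^ n) * ι F₂
  Σball²-ℚ = trans (cong ι Σball²≡2ⁿF₂) (ι-* (2 ℕ.^ n) F₂)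

  Σball·count-ℚ : ι Σball·count ≡ ι N * ι F₂
  Σball·count-ℚ = trans (cong ι Σball·count≡NF₂) (ι-* N F₂)

  nC2n : ℕ
  nC2n = n ℕ.* ((2 ℕ.* n) C n)

  volume-identity-ℚ : ι nC2n + (ι F₂ + ι F₂) ≡ ι (2 ℕ.^ n) * ι F₁ + ι (2 ℕ.^ n) * ι F₁
  volume-identity-ℚ = begin
    ι nC2n + (ι F₂ + ι F₂)                    ≡⟨ +-comm (ι nC2n) _ ⟩
    (ι F₂ + ι F₂) + ι nC2n                    ≡⟨ cong (_+ ι nC2n) (ι-+ F₂ F₂) ⟨
    ι (F₂ ℕ.+ F₂) + ι nC2n                    ≡⟨ ι-+ (F₂ ℕ.+ F₂) nC2n ⟨
    ι ((F₂ ℕ.+ F₂) ℕ.+ nC2n)                  ≡⟨ cong ι volume-identity ⟨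
    ι (2 ℕ.^ n ℕ.* F₁ ℕ.+ 2 ℕ.^ n ℕ.* F₁)     ≡⟨ trans (ι-+ (2 ℕ.^ n ℕ.* F₁) (2 ℕ.^ n ℕ.* F₁)) (cong₂ _+_ (ι-* (2 ℕ.^ n) F₁) (ι-* (2 ℕ.^ n) F₁)) ⟩
    ι (2 ℕ.^ n) * ι F₁ + ι (2 ℕ.^ n) * ι F₁   ∎

  Λ≡ : Λ n ≡ ι nC2n * h
  Λ≡ = /≡ι* nC2n (2 ℕ.^ suc n) {{m^n≢0 2 (suc n)}}

  ∑A·lam : sumℚ (map (λ w → A N z w * ι (lam n w)) (map suc (upTo n))) ≡ r * ι L
  ∑A·lam = begin
    ∑ℚ (map suc (upTo n)) (λ w → A N z w * ι (lam n w))            ≡⟨ ∑ℚ-cong (map suc (upTo n)) (λ w → cong (_* ι (lam n w)) (/≡ι* (pairsAt w) N)) ⟩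
    ∑ℚ (map suc (upTo n)) (λ w → (ι (pairsAt w) * r) * ι (lam n w)) ≡⟨ ∑ℚ-scaled-product (map suc (upTo n)) r pairsAt (lam n) ⟩
    r * ι (∑ (map suc (upTo n)) (λ w → pairsAt w ℕ.* lam n w))      ≡⟨ cong (λ s → r * ι s) ∑pairsAt·lam ⟩
    r * ι L                                                        ∎

open import Defs
open import Data.List using (map; upTo)
open import Data.Integer using (+_)
open import Data.Rational using (_+_; _-_; _*_; _/_)
open import Function.Definitions using (Injective)
open import Relation.Binary.PropositionalEquality using (_≡_; cong₂; module ≡-Reasoning)
open NatEmbedding using (ι)
open FieldAlgebra using (closing-algebra)

theorem3p3 : (n N : ℕ) .{{_ : NonZero N}} (z : Fin N → Vec Bool n) → Injective _≡_ _≡_ z →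
    DL2 N z ≡ Λ n - ((+ 1) / N) * sumℚ (map (λ w → A N z w * ((+ lam n w) / 1)) (map suc (upTo n)))
theorem3p3 n N z _ = begin
    DL2 N z
      ≡⟨ DL2-expansion ⟩
    r * r * ι Σcount² + m * m * ι Σball² - (r * m + r * m) * ι Σball·count
      ≡⟨ closing-algebra r (ι N) m (ι (2 ^ n)) h (ι F₁) (ι F₂) (ι L) (ι Σcount²) (ι Σball²) (ι Σball·count) (ι nC2n)
           r·N≡1 m·2ⁿ≡1 2ⁿ⁺¹·h≡1 Σcount²+L-ℚ Σball²-ℚ Σball·count-ℚ volume-identity-ℚ ⟩
    ι nC2n * h - r * (r * ι L)
      ≡⟨ cong₂ (λ u v → u - r * v) Λ≡ ∑A·lam ⟨
    Λ n - r * sumℚ (map (λ w → A N z w * ι (lam n w)) (map suc (upTo n))) ∎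
  where
  open ≡-Reasoning
  open Discrepancy n N z
  open Balls n using (F₁; F₂)
  open Configuration n N z using (Σcount²; Σball²; Σball·count; L)
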